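{- Let $N$ be an $\mathcal{L}$-network and $v\in V_{DP}(N)$. Then the set of directed paths starting at $v$, and consequently the $\mu$-vector $\mu(v,G)$, are the same for every rooted partner $G$ of $N$.
   Context: A semidirected graph is $N=(V,E)$ with $E=E_U\sqcup E_D$, $E_U$ undirected edges $uv$, $E_D$ directed edges $(u,v)$ ($u$ parent, $v$ child); parallel directed edges allowed, no self-loops. $\deg_i(v,N)$ is the number of directed edges with child $v$. $N'$ is compatible with $N$ if obtained by directing some undirected edges. A semidirected cycle is a semidirected graph whose undirected edges can be directed to make it a directed cycle; acyclic (SDAG) means containing no semidirected cycle; DAG = acyclic directed graph. Tree node: $\deg_i\le1$; hybrid node otherwise. Hybrid edge: directed edge with hybrid child; $E_H(N)$ their set. SDAG $N'$ is phylogenetically compatible with SDAG $N$ if compatible and $E_H(N')=E_H(N)$; a rooted partner of $N$ is a DAG phylogenetically compatible with $N$; a network is an SDAG admitting a rooted partner. In a DAG, a leaf is a node of out-degree 0. A node of a network is a rooted leaf if it is a leaf in every rooted partner, and an unrooted leaf if it is a leaf in some rooted partner. For a vector $\mathcal{L}=(\ell_1,\dots,\ell_n)$ of distinct labels, an $\mathcal{L}$-network is a network whose sets of rooted and unrooted leaves coincide and are bijectively labeled by elements of $\mathcal{L}$; its rooted partners then have exactly these leaves. For a DAG $G$ with leaves labeled by $\mathcal{L}$, $\mu(v,G)=(\mu_1,\dots,\mu_n)$ where $\mu_i$ is the number of directed paths in $G$ from $v$ to the leaf labeled $\ell_i$. A semidirected path from $u_0$ to $u_n$ is $u_0\dots u_n$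 with $u_{i-1}u_i$ or $(u_{i-1},u_i)$ an edge for each $i$; $v\lesssim u$ if there is a semidirected path from $u$ to $v$; $u\sim v$ if $u\lesssim v$ and $v\lesssim u$. An undirected component is the subgraph induced by a $\sim$-class; a root component is one whose class is maximal under $\lesssim$; $V_{DP}(N)$ is the set of nodes not in any root component. -}

module Defs where

open import Data.Nat using (ℕ; zero; suc; _≤_)
open import Data.Fin using (Fin; _≟_)
open import Data.Bool using (Bool; true; false; _∧_; if_then_else_)
open import Data.List using (List; []; _∷_; map; upTo)
open import Data.Nat.ListAction using (sum)
open import Data.List.Relation.Unary.Unique.Propositional using (Unique)
open import Data.List using (allFin) public
open import Data.Product using (Σ; Σ-syntax; ∃; ∃-syntax; _×_; _,_; proj₁; proj₂; swap)
open import Data.Sum using (_⊎_)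
open import Data.Vec using (Vec; tabulate)
open import Relation.Nullary using (¬_; does)
open import Relation.Binary.PropositionalEquality using (_≡_; _≢_)
open import Function.Bundles using (_⇔_)
open import Function.Definitions using (Injective)

-- Edge e has endpoints  ends e = (u , w).
--   * if  dir e ≡ true  the edge is the directed edge (u , w): u parent, w child;
--   * if  dir e ≡ false the edge is the undirected edge uw (the order is irrelevant).
-- Edges are individuals (indices), so parallel directed edges are allowed.
record SDG (n m : ℕ) : Set where
  field
    ends : Fin m → Fin n × Fin n
    dir  : Fin m → Bool

open SDG public

module _ {n m : ℕ} where

  tl hd : SDG n m → Fin m → Fin n
  tl N e = proj₁ (ends N e)
  hd N e = proj₂ (ends N e)

  WellFormed : SDG n m → Set
  WellFormed N =
    (∀ e → tl N e ≢ hd N e) ×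
    (∀ e e' → dir N e ≡ false → dir N e' ≡ false → e ≢ e' →
       ¬ (ends N e ≡ ends N e' ⊎ ends N e ≡ swap (ends N e')))

  Compatible : SDG n m → SDG n m → Set
  Compatible N' N = ∀ e →
    (dir N e ≡ true → dir N' e ≡ true × ends N' e ≡ ends N e) ×
    (dir N e ≡ false →
       (dir N' e ≡ false × ends N' e ≡ ends N e) ⊎
       (dir N' e ≡ true × (ends N' e ≡ ends N e ⊎ ends N' e ≡ swap (ends N e))))

  indeg : SDG n m → Fin n → ℕ
  indeg N v = sum (map (λ e → if dir N e ∧ does (hd N e ≟ v) then 1 else 0) (allFin m))

  Hybrid : SDG n m → Fin n → Set
  Hybrid N v = 2 ≤ indeg N v

  HybridEdge : SDG n m → Fin m → Set
  HybridEdge N e = dir N e ≡ true × Hybrid N (hd N e)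

  SDStep : SDG n m → Fin m → Fin n → Fin n → Set
  SDStep N e u w =
    (dir N e ≡ true × ends N e ≡ (u , w)) ⊎
    (dir N e ≡ false × (ends N e ≡ (u , w) ⊎ ends N e ≡ (w , u)))

  DStep : SDG n m → Fin m → Fin n → Fin n → Set
  DStep N e u w = dir N e ≡ true × ends N e ≡ (u , w)

  data Walk (S : Fin m → Fin n → Fin n → Set) : Fin n → Fin n → Set where
    []   : ∀ {u} → Walk S u u
    step : ∀ {u w v} (e : Fin m) → S e u w → Walk S w v → Walk S u v

  edgesOf : ∀ {S u v} → Walk S u v → List (Fin m)
  edgesOf []             = []
  edgesOf (step e _ p)   = e ∷ edgesOf p

  startsOf : ∀ {S u v} → Walk S u v → List (Fin n)
  startsOf {u = u} []   = []
  startsOf {u = u} (step e _ p) = u ∷ startsOf p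

  SemidirectedCycle : SDG n m → Set
  SemidirectedCycle N = Σ[ u ∈ Fin n ] Σ[ p ∈ Walk (SDStep N) u u ]
    (edgesOf p ≢ []) × Unique (edgesOf p) × Unique (startsOf p)

  Acyclic : SDG n m → Set
  Acyclic N = ¬ SemidirectedCycle N

  IsDAG : SDG n m → Set
  IsDAG G = (∀ e → dir G e ≡ true) × Acyclic G

  RootedPartner : SDG n m → SDG n m → Set
  RootedPartner N G =
    IsDAG G × Compatible G N × (∀ e → HybridEdge G e ⇔ HybridEdge N e)

  Network : SDG n m → Set
  Network N = WellFormed N × Acyclic N × Σ[ G ∈ SDG n m ] RootedPartner N G

  Leaf : SDG n m → Fin n → Set
  Leaf G v = ∀ e → dir G e ≡ true → tl G e ≢ v

  RootedLeaf : SDG n m → Fin n → Set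
  RootedLeaf N v = ∀ G → RootedPartner N G → Leaf G v

  UnrootedLeaf : SDG n m → Fin n → Set
  UnrootedLeaf N v = Σ[ G ∈ SDG n m ] RootedPartner N G × Leaf G v

  -- L-network, L = (ℓ₁,…,ℓ_k) identified with Fin k; lab i is the node labelled ℓ_i
  LNetwork : ∀ {k} → SDG n m → (Fin k → Fin n) → Set
  LNetwork N lab =
    Network N ×
    (∀ v → RootedLeaf N v ⇔ UnrootedLeaf N v) ×
    Injective _≡_ _≡_ lab ×
    (∀ v → RootedLeaf N v ⇔ (∃[ i ] lab i ≡ v))

  _≲⟨_⟩_ : Fin n → SDG n m → Fin n → Set
  v ≲⟨ N ⟩ u = Walk (SDStep N) u v

  -- u lies in a root component: its ~-class is maximal w.r.t. ≲
  InRootComponent : SDG n m → Fin n → Set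
  InRootComponent N u = ∀ w → u ≲⟨ N ⟩ w → w ≲⟨ N ⟩ u

  InVDP : SDG n m → Fin n → Set
  InVDP N v = ¬ InRootComponent N v

  DPathFrom : SDG n m → Fin n → List (Fin m) → Set
  DPathFrom G v es = Σ[ w ∈ Fin n ] Σ[ p ∈ Walk (DStep G) v w ] edgesOf p ≡ es

  walksLen : SDG n m → ℕ → Fin n → Fin n → ℕ
  walksLen G zero    u t = if does (u ≟ t) then 1 else 0
  walksLen G (suc k) u t =
    sum (map (λ e → if dir G e ∧ does (tl G e ≟ u) then walksLen G k (hd G e) t else 0)
             (allFin m))

  -- number of directed paths from u to t in a DAG G (all have length < n)
  npaths : SDG n m → Fin n → Fin n → ℕ
  npaths G u t = sum (map (λ k → walksLen G k u t) (upTo n))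

  μ : ∀ {k} → SDG n m → (Fin k → Fin n) → Fin n → Vec ℕ k
  μ G lab v = tabulate (λ i → npaths G v (lab i))

{-# OPTIONS --safe #-}
-- A node u outside the root components is reached from a directed edge of N by a walk
-- along undirected edges of N that never immediately reuses an edge.  In a rooted
-- partner every edge of that walk must point forward: an edge pointing back into a
-- node that already has an incoming edge makes that node hybrid, so the edge would be
-- a hybrid edge, and hybrid edges are directed already in N.  Hence the last edge of
-- the walk enters u in every rooted partner, and every other undirected edge at u
-- leaves u.  So all rooted partners have the same out-edges at u, and since V_DP(N)
-- is closed under taking children, also the same directed paths from u.
module Submission where

open import Defs
open import Data.Nat using (ℕ; zero; suc; _≤_; _+_)
open import Data.Nat.Properties using (≤-trans; ≤-reflexive; m≤m+n; m≤n+m; +-monoʳ-≤; +-comm; module ≤-Reasoning)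
open import Data.Fin using (Fin; zero; suc; _≟_)
open import Data.Bool using (true; false; _∧_; if_then_else_)
open import Data.Bool.Properties using (⇔→≡)
open import Data.List using (List; []; _∷_; upTo; tabulate)
open import Data.List.Properties using (map-tabulate; map-cong)
open import Data.Nat.ListAction using (sum)
open import Data.List.Relation.Unary.AllPairs using ([]; _∷_)
open import Data.List.Relation.Unary.All using ([])
open import Data.Product using (Σ-syntax; _×_; _,_; proj₁; proj₂; map₂; swap)
open import Data.Product.Properties using (≡-dec; ,-injective)
open import Data.Sum using (_⊎_; inj₁; inj₂; [_,_]′)
open import Data.Empty using (⊥-elim)
open import Data.Vec.Properties using (tabulate-cong)
open import Function using (_∘_; id)
open import Relation.Nullary using (¬_; does; yes; no)
open import Relation.Binary.PropositionalEquality
  using (_≡_; _≢_; refl; sym; trans; cong; cong₂; subst; module ≡-Reasoning)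
open import Function.Bundles using (_⇔_; mk⇔; Equivalence)
import Function.Properties.Equivalence as ⇔

open Equivalence using (to; from)

true≢false : true ≢ false
true≢false ()

term≤sum : ∀ {m} (g : Fin m → ℕ) a → g a ≤ sum (tabulate g)
term≤sum g zero    = m≤m+n (g zero) _
term≤sum g (suc a) = ≤-trans (term≤sum (g ∘ suc) a) (m≤n+m _ (g zero))

twoTerms≤sum : ∀ {m} (g : Fin m → ℕ) {a b} → a ≢ b → g a + g b ≤ sum (tabulate g)
twoTerms≤sum g {zero}  {zero}  a≢b = ⊥-elim (a≢b refl)
twoTerms≤sum g {zero}  {suc b} _   = +-monoʳ-≤ (g zero) (term≤sum (g ∘ suc) b)
twoTerms≤sum g {suc a} {zero}  _   =
  ≤-trans (≤-reflexive (+-comm (g (suc a)) (g zero))) (+-monoʳ-≤ (g zero) (term≤sum (g ∘ suc) a))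
twoTerms≤sum g {suc a} {suc b} a≢b =
  ≤-trans (twoTerms≤sum (g ∘ suc) (a≢b ∘ cong suc)) (m≤n+m _ (g zero))

fst snd : {A : Set} → A × A → A
fst = proj₁
snd = proj₂

module _ {n m : ℕ} where

  _++ʷ_ : ∀ {S : Fin m → Fin n → Fin n → Set} {a b c} → Walk S a b → Walk S b c → Walk S a c
  []         ++ʷ q = q
  step e s p ++ʷ q = step e s (p ++ʷ q)

  InEdge : SDG n m → Fin m → Fin n → Set
  InEdge H e t = dir H e ≡ true × hd H e ≡ t

  DStep⇒InEdge : ∀ H {e u w} → DStep H e u w → InEdge H e w
  DStep⇒InEdge H (dH , ends≡) = dH , cong snd ends≡

  ∃DStep⇔out-test : ∀ (H : SDG n m) e u →
    (Σ[ w ∈ Fin n ] DStep H e u w) ⇔ (dir H e ∧ does (tl H e ≟ u) ≡ true)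
  ∃DStep⇔out-test H e u = mk⇔ test-passes passes-test
    where
    test-passes : Σ[ w ∈ Fin n ] DStep H e u w → dir H e ∧ does (tl H e ≟ u) ≡ true
    test-passes (_ , dH , ends≡) rewrite dH with tl H e ≟ u
    ... | yes _  = refl
    ... | no tl≢ = ⊥-elim (tl≢ (cong fst ends≡))
    passes-test : dir H e ∧ does (tl H e ≟ u) ≡ true → Σ[ w ∈ Fin n ] DStep H e u w
    passes-test passes with dir H e | tl H e ≟ u | passes
    ... | true | yes tl≡ | _ = hd H e , refl , cong (_, hd H e) tl≡

  UStep : SDG n m → Fin m → Fin n → Fin n → Set
  UStep N e u w = dir N e ≡ false × (ends N e ≡ (u , w) ⊎ ends N e ≡ (w , u))

  UStep-flip : ∀ N {e u w} → UStep N e u w → UStep N e w u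
  UStep-flip N (dN , inj₁ ends≡) = dN , inj₂ ends≡
  UStep-flip N (dN , inj₂ ends≡) = dN , inj₁ ends≡

  UStep-backtrack : ∀ N {f t₀ t x} → UStep N f t₀ t → UStep N f t x → x ≡ t₀
  UStep-backtrack N (_ , inj₁ a) (_ , inj₁ b) = let p , q = ,-injective (trans (sym a) b) in sym (trans p q)
  UStep-backtrack N (_ , inj₁ a) (_ , inj₂ b) = sym (proj₁ (,-injective (trans (sym a) b)))
  UStep-backtrack N (_ , inj₂ a) (_ , inj₁ b) = sym (proj₂ (,-injective (trans (sym a) b)))
  UStep-backtrack N (_ , inj₂ a) (_ , inj₂ b) = let p , q = ,-injective (trans (sym a) b) in trans (sym p) (sym q)

  reverse-undirected : ∀ N {a b} → Walk (UStep N) a b → Walk (SDStep N) b a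
  reverse-undirected N p = go p []
    where
    go : ∀ {a b c} → Walk (UStep N) a b → Walk (SDStep N) a c → Walk (SDStep N) b c
    go []           acc = acc
    go (step f s p) acc = go p (step f (inj₂ (UStep-flip N s)) acc)

  in-edge-counted : ∀ H {e t} → InEdge H e t → (if dir H e ∧ does (hd H e ≟ t) then 1 else 0) ≡ 1
  in-edge-counted H {e} {t} (dH , hH) rewrite dH with hd H e ≟ t
  ... | yes _   = refl
  ... | no hH≢t = ⊥-elim (hH≢t hH)

  in-edges⇒Hybrid : ∀ H {d f t} → d ≢ f → InEdge H d t → InEdge H f t → Hybrid H t
  in-edges⇒Hybrid H {d} {f} {t} d≢f inD inF = begin
    2                      ≡⟨ cong₂ _+_ (sym (in-edge-counted H inD)) (sym (in-edge-counted H inF)) ⟩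
    counted d + counted f  ≤⟨ twoTerms≤sum counted d≢f ⟩
    sum (tabulate counted) ≡⟨ cong sum (map-tabulate id counted) ⟨
    indeg H t              ∎
    where
    open ≤-Reasoning
    counted : Fin m → ℕ
    counted e = if dir H e ∧ does (hd H e ≟ t) then 1 else 0

  DAG-no-loop : ∀ (G : SDG n m) {e u w} → IsDAG G → DStep G e u w → ¬ InEdge G e u
  DAG-no-loop G {e} {u} (_ , acyclic) s (_ , hd≡u) =
    acyclic (u , step e (inj₁ loop) [] , (λ ()) , [] ∷ [] , [] ∷ [])
    where
    loop : DStep G e u u
    loop = subst (DStep G e u) (trans (sym (proj₂ (DStep⇒InEdge G s))) hd≡u) s

module OutEdgeAgreement {n m : ℕ} (G G' : SDG n m) (P : Fin n → Set)
  (closed : ∀ {e u w} → P u → DStep G e u w → P w)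
  (agree  : ∀ {e u w} → P u → DStep G e u w ⇔ DStep G' e u w) where

  walk-transport : ∀ {u w} → P u → (p : Walk (DStep G) u w) →
    Σ[ q ∈ Walk (DStep G') u w ] edgesOf q ≡ edgesOf p
  walk-transport _  []           = [] , refl
  walk-transport pu (step e s p) with walk-transport (closed pu s) p
  ... | q , same = step e (to (agree pu) s) q , cong (e ∷_) same

  DPathFrom-transport : ∀ {v es} → P v → DPathFrom G v es → DPathFrom G' v es
  DPathFrom-transport pv (w , p , edges≡) with walk-transport pv p
  ... | q , same = w , q , trans same edges≡

  walksLen-agree : ∀ k {u} → P u → ∀ t → walksLen G k u t ≡ walksLen G' k u t
  walksLen-agree zero    _ t = refl
  walksLen-agree (suc k) {u} pu t = cong sum (map-cong term-agree (allFin m))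
    where
    out-test-agree : ∀ e → dir G e ∧ does (tl G e ≟ u) ≡ dir G' e ∧ does (tl G' e ≟ u)
    out-test-agree e = ⇔→≡ (⇔.trans (⇔.sym (∃DStep⇔out-test G e u))
                             (⇔.trans out-edge-agree (∃DStep⇔out-test G' e u)))
      where
      out-edge-agree : (Σ[ w ∈ Fin n ] DStep G e u w) ⇔ (Σ[ w ∈ Fin n ] DStep G' e u w)
      out-edge-agree = mk⇔ (map₂ (to (agree pu))) (map₂ (from (agree pu)))

    term-agree : ∀ e → (if dir G e ∧ does (tl G e ≟ u) then walksLen G k (hd G e) t else 0)
                     ≡ (if dir G' e ∧ does (tl G' e ≟ u) then walksLen G' k (hd G' e) t else 0)
    term-agree e rewrite out-test-agree e with dir G' e ∧ does (tl G' e ≟ u) in test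
    ... | false = refl
    ... | true with from (∃DStep⇔out-test G' e u) test
    ...   | w , s' = begin
      walksLen G k (hd G e) t    ≡⟨ cong (λ x → walksLen G k x t) (proj₂ (DStep⇒InEdge G s)) ⟩
      walksLen G k w t           ≡⟨ walksLen-agree k (closed pu s) t ⟩
      walksLen G' k w t          ≡⟨ cong (λ x → walksLen G' k x t) (proj₂ (DStep⇒InEdge G' s')) ⟨
      walksLen G' k (hd G' e) t  ∎
      where
      open ≡-Reasoning
      s = from (agree pu) s'

  npaths-agree : ∀ {u} → P u → ∀ t → npaths G u t ≡ npaths G' u t
  npaths-agree pu t = cong sum (map-cong (λ k → walksLen-agree k pu t) (upTo n))

module _ {n m : ℕ} where

  Compatible-directed : ∀ (H N : SDG n m) {e u w} → Compatible H N → DStep N e u w → DStep H e u w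
  Compatible-directed H N {e} comp (dN , ends≡) =
    let dH , kept = proj₁ (comp e) dN in dH , trans kept ends≡

  Compatible-step : ∀ (H N : SDG n m) {e u w} → Compatible H N → DStep H e u w → SDStep N e u w
  Compatible-step H N {e} comp (dH , ends≡) with dir N e in dN
  ... | true  = inj₁ (refl , trans (sym (proj₂ (proj₁ (comp e) dN))) ends≡)
  ... | false with proj₂ (comp e) dN
  ...   | inj₁ (dH' , _)         = ⊥-elim (true≢false (trans (sym dH) dH'))
  ...   | inj₂ (_ , inj₁ kept)    = inj₂ (refl , inj₁ (trans (sym kept) ends≡))
  ...   | inj₂ (_ , inj₂ swapped) = inj₂ (refl , inj₂ (cong swap (trans (sym swapped) ends≡)))

  Compatible-undirected : ∀ (H N : SDG n m) {f t t'} → Compatible H N → dir H f ≡ true →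
    UStep N f t t' → DStep H f t t' ⊎ DStep H f t' t
  Compatible-undirected H N {f} {t} {t'} comp dH (fN , ends≡) with proj₂ (comp f) fN
  ... | inj₁ (dH' , _)    = ⊥-elim (true≢false (trans (sym dH) dH'))
  ... | inj₂ (_ , ends≡') = orient ends≡' ends≡
    where
    orient : ends H f ≡ ends N f ⊎ ends H f ≡ swap (ends N f) →
             ends N f ≡ (t , t') ⊎ ends N f ≡ (t' , t) → DStep H f t t' ⊎ DStep H f t' t
    orient (inj₁ a) (inj₁ b) = inj₁ (dH , trans a b)
    orient (inj₁ a) (inj₂ b) = inj₂ (dH , trans a b)
    orient (inj₂ a) (inj₁ b) = inj₂ (dH , trans a (cong swap b))
    orient (inj₂ a) (inj₂ b) = inj₁ (dH , trans a (cong swap b))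

  -- Pointing back into t, f would be a hybrid edge of H next to d, hence directed in N.
  undirected-edge-leaves : ∀ (N H : SDG n m) {d f t t'} → RootedPartner N H → InEdge H d t →
    f ≢ d → UStep N f t t' → DStep H f t t'
  undirected-edge-leaves N H {d} {f} ((directed , _) , comp , hybrid) inD f≢d u
    with Compatible-undirected H N comp (directed f) u
  ... | inj₁ s = s
  ... | inj₂ s = ⊥-elim (true≢false (trans (sym fN) (proj₁ u)))
    where
    inF = DStep⇒InEdge H s
    fN : dir N f ≡ true
    fN = proj₁ (to (hybrid f) (directed f , subst (Hybrid H) (sym (proj₂ inF))
                                               (in-edges⇒Hybrid H (f≢d ∘ sym) inD inF)))

  -- Entered N L u: u is reached from a directed edge of N by a walk along undirected
  -- edges of N that never immediately reuses an edge, and L is the last edge used.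
  data Entered (N : SDG n m) : Fin m → Fin n → Set where
    directed : ∀ {d t} → InEdge N d t → Entered N d t
    extend   : ∀ {d f t t'} → Entered N d t → UStep N f t t' → f ≢ d → Entered N f t'

  Entered⇒InEdge : ∀ {N} (H : SDG n m) {L u} → RootedPartner N H → Entered N L u → InEdge H L u
  Entered⇒InEdge H (_ , comp , _) (directed {d} (dN , hN)) =
    let dH , kept = proj₁ (comp d) dN in dH , trans (cong snd kept) hN
  Entered⇒InEdge {N} H pH (extend en s f≢d) =
    DStep⇒InEdge H (undirected-edge-leaves N H pH (Entered⇒InEdge H pH en) f≢d s)

  Entered-retreat : ∀ {N f t t'} → Entered N f t → UStep N f t t' → Σ[ L ∈ Fin m ] Entered N L t'
  Entered-retreat     (directed (dN , _)) (fN , _) = ⊥-elim (true≢false (trans (sym dN) fN))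
  Entered-retreat {N} (extend en s' _)    s        = _ , subst (Entered N _) (sym (UStep-backtrack N s' s)) en

  Entered-along : ∀ {N d t u} → Entered N d t → Walk (UStep N) t u → Σ[ L ∈ Fin m ] Entered N L u
  Entered-along en [] = _ , en
  Entered-along {d = d} en (step f s p) with f ≟ d
  ... | yes refl = Entered-along (proj₂ (Entered-retreat en s)) p
  ... | no f≢d   = Entered-along (extend en s f≢d) p

  Entered-or-undirected : ∀ (N : SDG n m) {x u} → Walk (SDStep N) x u →
    (Σ[ L ∈ Fin m ] Entered N L u) ⊎ Walk (UStep N) x u
  Entered-or-undirected N [] = inj₂ []
  Entered-or-undirected N (step f s p) with Entered-or-undirected N p | s
  ... | inj₁ en | _      = inj₁ en
  ... | inj₂ q  | inj₁ d = inj₁ (Entered-along (directed (DStep⇒InEdge N d)) q)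
  ... | inj₂ q  | inj₂ u = inj₂ (step f u q)

  unentered⇒InRootComponent : ∀ (N : SDG n m) {u} → (∀ L → ¬ Entered N L u) → InRootComponent N u
  unentered⇒InRootComponent N ¬entered x p with Entered-or-undirected N p
  ... | inj₁ (L , en) = ⊥-elim (¬entered L en)
  ... | inj₂ q        = reverse-undirected N q

  InVDP-step : ∀ (N : SDG n m) {e u w} → SDStep N e u w → InVDP N u → InVDP N w
  InVDP-step N {e} s vdp root = vdp (λ x p → step e s (root x (p ++ʷ step e s [])))

  Entered-out-edge : ∀ (N G G' : SDG n m) {L e u w} → RootedPartner N G → RootedPartner N G' →
    Entered N L u → DStep G e u w → DStep G' e u w
  Entered-out-edge N G G' {L} {e} pG pG' en s with e ≟ L
  ... | yes refl = ⊥-elim (DAG-no-loop G (proj₁ pG) s (Entered⇒InEdge G pG en))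
  ... | no e≢L = [ Compatible-directed G' N (proj₁ (proj₂ pG'))
                 , undirected-edge-leaves N G' pG' (Entered⇒InEdge G' pG' en) e≢L
                 ]′ (Compatible-step G N (proj₁ (proj₂ pG)) s)

  -- InVDP is a negation, so no entering walk can be extracted from it; instead we refute
  -- the decidable failure of the conclusion.
  InVDP-out-edge : ∀ (N G G' : SDG n m) {e u w} → RootedPartner N G → RootedPartner N G' →
    InVDP N u → DStep G e u w → DStep G' e u w
  InVDP-out-edge N G G' {e} {u} {w} pG pG' vdp s with ≡-dec _≟_ _≟_ (ends G' e) (u , w)
  ... | yes ends≡ = proj₁ (proj₁ pG') e , ends≡
  ... | no ends≢  = ⊥-elim (vdp (unentered⇒InRootComponent N
                      (λ L en → ends≢ (proj₂ (Entered-out-edge N G G' pG pG' en s)))))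

  InVDP-child : ∀ (N G : SDG n m) {e u w} → RootedPartner N G → InVDP N u → DStep G e u w → InVDP N w
  InVDP-child N G (_ , comp , _) vdp s = InVDP-step N (Compatible-step G N comp s) vdp

  InVDP-out-edges-agree : ∀ (N G G' : SDG n m) {e u w} → RootedPartner N G → RootedPartner N G' →
    InVDP N u → DStep G e u w ⇔ DStep G' e u w
  InVDP-out-edges-agree N G G' pG pG' vdp =
    mk⇔ (InVDP-out-edge N G G' pG pG' vdp) (InVDP-out-edge N G' G pG' pG vdp)

  InVDP-DPathFrom : ∀ (N G G' : SDG n m) {v es} → RootedPartner N G → RootedPartner N G' →
    InVDP N v → DPathFrom G v es → DPathFrom G' v es
  InVDP-DPathFrom N G G' pG pG' = OutEdgeAgreement.DPathFrom-transport G G' (InVDP N)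
    (InVDP-child N G pG) (InVDP-out-edges-agree N G G' pG pG')

  InVDP-npaths : ∀ (N G G' : SDG n m) {v} → RootedPartner N G → RootedPartner N G' →
    InVDP N v → ∀ t → npaths G v t ≡ npaths G' v t
  InVDP-npaths N G G' pG pG' = OutEdgeAgreement.npaths-agree G G' (InVDP N)
    (InVDP-child N G pG) (InVDP-out-edges-agree N G G' pG pG')

-- The L-network hypothesis is unused: only the rooted-partner hypotheses matter.
proposition10 : ∀ {n m k} (N : SDG n m) (lab : Fin k → Fin n) →
    LNetwork N lab → (v : Fin n) → InVDP N v →
    (G G' : SDG n m) → RootedPartner N G → RootedPartner N G' →
    (∀ (es : List (Fin m)) → DPathFrom G v es ⇔ DPathFrom G' v es) ×
    μ G lab v ≡ μ G' lab v
proposition10 N lab _ v vdp G G' pG pG' =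
  (λ es → mk⇔ (InVDP-DPathFrom N G G' pG pG' vdp) (InVDP-DPathFrom N G' G pG' pG vdp)) ,
  tabulate-cong (λ i → InVDP-npaths N G G' pG pG' vdp (lab i))
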